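{- Let $\lambda$ be a $\Delta$-periodic labeling of a connected graph $G$. Then for any two distinct vertices $u$ and $v$, the stretch for $(u,v)$ under $\lambda$ is at most $\Delta-\frac{\Delta-1}{\operatorname{dist}(u,v)}$.
   Context: A $\Delta$-periodic labeling of $G=(V,E)$ is a function $\lambda:E\to\{1,\dots,\Delta\}$; edge $e$ is available exactly at times $\lambda(e)+i\Delta$, $i\ge0$. A temporal path from $s$ to $z$ is a path $s=v_0,\dots,v_k=z$ with distinct vertices and times $t_1<\dots<t_k$ with $\{v_{i-1},v_i\}$ available at $t_i$; its duration is $t_k-t_1+1$. The stretch for $(u,v)$ under $\lambda$ is (minimum duration of a temporal path from $u$ to $v$)$/\operatorname{dist}_G(u,v)$. -}

module Defs where

open import Data.Nat using (ℕ; zero; suc; _+_; _*_; _∸_; _≤_; _<_; NonZero)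
open import Data.Fin using (Fin)
open import Data.List using (List; []; _∷_; _∷ʳ_; length)
open import Data.List.Relation.Unary.Unique.Propositional using (Unique)
open import Data.Product using (Σ; ∃; _×_; _,_)
open import Data.Integer using (+_)
open import Data.Rational using (ℚ; _/_; _-_) renaming (_≤_ to _≤ℚ_)
open import Relation.Binary.PropositionalEquality using (_≡_)
open import Relation.Nullary using (¬_)

record Graph (n : ℕ) : Set₁ where
  field
    Adj     : Fin n → Fin n → Set
    adj-sym : ∀ {u v} → Adj u v → Adj v u
    irrefl  : ∀ {u} → ¬ Adj u u
open Graph public

data Walk {n : ℕ} (G : Graph n) : Fin n → Fin n → ℕ → Set where
  here : ∀ {x} → Walk G x x 0
  step : ∀ {x y z k} → Adj G x y → Walk G y z k → Walk G x z (suc k)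

Connected : ∀ {n} → Graph n → Set
Connected G = ∀ u v → ∃ λ k → Walk G u v k

IsDist : ∀ {n} → Graph n → Fin n → Fin n → ℕ → Set
IsDist G u v d = Walk G u v d × (∀ k → Walk G u v k → d ≤ k)

-- A Δ-periodic labeling λ : E → {1,…,Δ}, encoded as a symmetric function on
-- ordered pairs whose values matter only on edges.
record Labeling {n : ℕ} (G : Graph n) (Δ : ℕ) : Set where
  field
    lab       : Fin n → Fin n → ℕ
    lab-sym   : ∀ {u v} → Adj G u v → lab u v ≡ lab v u
    lab-range : ∀ {u v} → Adj G u v → 1 ≤ lab u v × lab u v ≤ Δ
open Labeling public

Available : ∀ {n G Δ} → Labeling {n} G Δ → Fin n → Fin n → ℕ → Set
Available {Δ = Δ} L u v t = ∃ λ i → t ≡ lab L u v + i * Δ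

-- Temporal walk from x to z, with at least one edge; indices: time t₁ of the
-- first edge and time tₖ of the last edge. Times strictly increase.
data TWalk {n : ℕ} {G : Graph n} {Δ : ℕ} (L : Labeling G Δ)
     : Fin n → Fin n → ℕ → ℕ → Set where
  first : ∀ {x y t} → Adj G x y → Available L x y t → TWalk L x y t t
  extend : ∀ {x y z t₁ t t'} → TWalk L x y t₁ t → Adj G y z → Available L y z t'
         → t < t' → TWalk L x z t₁ t'

verts : ∀ {n G Δ} {L : Labeling {n} G Δ} {x z t₁ tₖ} → TWalk L x z t₁ tₖ → List (Fin n)
verts (first {x = x} {y = y} _ _) = x ∷ y ∷ []
verts (extend {z = z} w _ _ _) = verts w ∷ʳ z

TemporalPath : ∀ {n G Δ} → Labeling {n} G Δ → Fin n → Fin n → ℕ → ℕ → Set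
TemporalPath L x z t₁ tₖ = Σ (TWalk L x z t₁ tₖ) (λ w → Unique (verts w))

duration : ℕ → ℕ → ℕ
duration t₁ tₖ = tₖ ∸ t₁ + 1

-- "stretch(u,v) under λ ≤ q", where dist(u,v) = d > 0. Since durations are
-- natural numbers, the minimum duration is ≤ D iff some temporal path has
-- duration ≤ D; so this literally unfolds (min duration)/d ≤ q.
StretchAtMost : ∀ {n G Δ} → Labeling {n} G Δ → Fin n → Fin n
              → (d : ℕ) → .{{_ : NonZero d}} → ℚ → Set
StretchAtMost L u v d q =
  ∃ λ t₁ → ∃ λ tₖ → TemporalPath L u v t₁ tₖ × ((+ duration t₁ tₖ) / d ≤ℚ q)

{-# OPTIONS --safe #-}
-- Follow a shortest u–v walk (a path, since it is shortest) and cross each edge at its first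
-- availability after the previous crossing.  Consecutive crossings are at most Δ apart, so a
-- path with dist(u,v) = d edges has duration at most (d − 1)Δ + 1, i.e. stretch at most
-- ((d − 1)Δ + 1)/d = Δ − (Δ − 1)/d.
module Submission where

open import Defs
open import Data.Nat using (ℕ; zero; suc; _+_; _*_; _∸_; _≤_; _<_; NonZero; s≤s; s≤s⁻¹; _<?_)
open import Data.Nat.Properties
open import Data.Fin using (Fin)
open import Data.Integer using (+_)
import Data.Integer as ℤ
import Data.Integer.Properties as ℤ
open import Data.Rational using (_/_; -_; _-_; toℚᵘ) renaming (_≤_ to _≤ℚ_; _+_ to _+ℚ_)
import Data.Rational.Properties as ℚ
import Data.Rational.Unnormalised as ℚᵘ
import Data.Rational.Unnormalised.Properties as ℚᵘ
open import Algebra.Properties.Group ℚ.+-0-group using (//-rightDividesʳ)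
open import Data.List using (List; []; _∷_; _++_)
open import Data.List.Properties using (++-assoc; ++-identityʳ)
open import Data.List.Membership.Propositional using (_∈_; _∉_)
open import Data.List.Relation.Unary.Any using (here; there)
open import Data.List.Relation.Unary.All using ([])
open import Data.List.Relation.Unary.All.Properties using (¬Any⇒All¬)
open import Data.List.Relation.Unary.AllPairs using ([]; _∷_)
open import Data.List.Relation.Unary.Unique.Propositional using (Unique)
open import Data.Product using (Σ; ∃; ∃₂; _×_; _,_; proj₁; proj₂)
open import Relation.Binary.PropositionalEquality
open import Relation.Nullary using (yes; no)

module _ {n} {G : Graph n} where

  walkTail : ∀ {x y k} → Walk G x y k → List (Fin n)
  walkTail here = []
  walkTail (step {y = y} _ w) = y ∷ walkTail w

  walkVertices : ∀ {x y k} → Walk G x y k → List (Fin n)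
  walkVertices {x} w = x ∷ walkTail w

  ∈-walkVertices⇒suffix : ∀ {x y z k} (w : Walk G x z k) → y ∈ walkVertices w →
                          ∃ λ j → j ≤ k × Walk G y z j
  ∈-walkVertices⇒suffix w (here refl) = _ , ≤-refl , w
  ∈-walkVertices⇒suffix (step _ w) (there y∈w) =
    let j , j≤k , w′ = ∈-walkVertices⇒suffix w y∈w in j , m≤n⇒m≤1+n j≤k , w′

  shortest⇒unique : ∀ {x z k} (w : Walk G x z k) → (∀ j → Walk G x z j → k ≤ j) →
                    Unique (walkVertices w)
  shortest⇒unique here _ = [] ∷ []
  shortest⇒unique {x} (step a w) shortest =
    ¬Any⇒All¬ _ x∉w ∷ shortest⇒unique w (λ j w′ → s≤s⁻¹ (shortest (suc j) (step a w′)))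
    where
    x∉w : x ∉ walkVertices w
    x∉w x∈w = let j , j≤k , w′ = ∈-walkVertices⇒suffix w x∈w in <⇒≱ (s≤s j≤k) (shortest j w′)

next-periodic-time : ∀ {ℓ Δ} → 1 ≤ ℓ → ℓ ≤ Δ → ∀ t →
                     ∃ λ i → t < ℓ + i * Δ × ℓ + i * Δ ≤ t + Δ
next-periodic-time {ℓ} 1≤ℓ ℓ≤Δ zero =
  0 , ≤-trans 1≤ℓ (m≤m+n ℓ 0) , ≤-trans (≤-reflexive (+-identityʳ ℓ)) ℓ≤Δ
next-periodic-time {ℓ} {Δ} 1≤ℓ ℓ≤Δ (suc t) with next-periodic-time 1≤ℓ ℓ≤Δ t
... | i , t<ℓ+iΔ , ℓ+iΔ≤t+Δ with suc t <? ℓ + i * Δ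
...   | yes 1+t<ℓ+iΔ = i , 1+t<ℓ+iΔ , m≤n⇒m≤1+n ℓ+iΔ≤t+Δ
...   | no 1+t≮ℓ+iΔ = suc i , 1+t<ℓ+[1+i]Δ , ≤-reflexive ℓ+[1+i]Δ≡1+t+Δ
  where
  ℓ+[1+i]Δ≡1+t+Δ : ℓ + suc i * Δ ≡ suc t + Δ
  ℓ+[1+i]Δ≡1+t+Δ = begin
    ℓ + (Δ + i * Δ)  ≡⟨ cong (λ m → ℓ + m) (+-comm (i * Δ) Δ) ⟨
    ℓ + (i * Δ + Δ)  ≡⟨ +-assoc ℓ (i * Δ) Δ ⟨
    ℓ + i * Δ + Δ    ≡⟨ cong (_+ Δ) (≤-antisym (≮⇒≥ 1+t≮ℓ+iΔ) t<ℓ+iΔ) ⟩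
    suc t + Δ        ∎
    where open ≡-Reasoning
  1+t<ℓ+[1+i]Δ : suc t < ℓ + suc i * Δ
  1+t<ℓ+[1+i]Δ rewrite ℓ+[1+i]Δ≡1+t+Δ = m<m+n (suc t) (≤-trans 1≤ℓ ℓ≤Δ)

module _ {n} {G : Graph n} {Δ} (L : Labeling G Δ) where

  next-available : ∀ {y z} → Adj G y z → ∀ t → ∃ λ t′ → Available L y z t′ × t < t′ × t′ ≤ t + Δ
  next-available a t =
    let i , t<t′ , t′≤t+Δ = next-periodic-time (proj₁ (lab-range L a)) (proj₂ (lab-range L a)) t
    in _ , (i , refl) , t<t′ , t′≤t+Δ

  extend-along : ∀ {x y z t₁ t k} (tw : TWalk L x y t₁ t) (w : Walk G y z k) →
                 ∃ λ t′ → Σ (TWalk L x z t₁ t′) λ tw′ →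
                   t′ ≤ t + k * Δ × verts tw′ ≡ verts tw ++ walkTail w
  extend-along {t = t} tw here = t , tw , ≤-reflexive (sym (+-identityʳ t)) , sym (++-identityʳ _)
  extend-along {t = t} {k = suc k} tw (step {y = y} a w) =
    let t₂ , av , t<t₂ , t₂≤t+Δ = next-available a t
        t′ , tw′ , t′≤t₂+kΔ , verts≡ = extend-along (extend tw a av t<t₂) w
    in t′ , tw′ , bound t₂≤t+Δ t′≤t₂+kΔ , trans verts≡ (++-assoc (verts tw) (y ∷ []) (walkTail w))
    where
    bound : ∀ {t₂ t′} → t₂ ≤ t + Δ → t′ ≤ t₂ + k * Δ → t′ ≤ t + suc k * Δ
    bound {t₂} {t′} t₂≤t+Δ t′≤t₂+kΔ = begin
      t′              ≤⟨ t′≤t₂+kΔ ⟩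
      t₂ + k * Δ      ≤⟨ +-monoˡ-≤ (k * Δ) t₂≤t+Δ ⟩
      t + Δ + k * Δ   ≡⟨ +-assoc t Δ (k * Δ) ⟩
      t + suc k * Δ   ∎
      where open ≤-Reasoning

  shortest-walk⇒temporal-path : ∀ {u v k} (w : Walk G u v (suc k)) →
                                (∀ j → Walk G u v j → suc k ≤ j) →
                                ∃₂ λ t₁ tₖ → TemporalPath L u v t₁ tₖ × tₖ ≤ t₁ + k * Δ
  shortest-walk⇒temporal-path (step a w) shortest =
    let t′ , tw , t′≤ , verts≡ = extend-along (first a (0 , refl)) w
    in _ , t′ , (tw , subst Unique (sym verts≡) (shortest⇒unique (step a w) shortest)) , t′≤

p+q≤r⇒p≤r-q : ∀ {p q r} → p +ℚ q ≤ℚ r → p ≤ℚ r - q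
p+q≤r⇒p≤r-q {p} {q} {r} p+q≤r = begin
  p            ≡⟨ //-rightDividesʳ q p ⟨
  p +ℚ q - q   ≤⟨ ℚ.+-monoˡ-≤ (- q) p+q≤r ⟩
  r - q        ∎
  where open ℚ.≤-Reasoning

-- Cross-multiplied in ℚᵘ, where a/d + c/d has denominator d * d.
fractions-sum≤ : ∀ a c m d .{{_ : NonZero d}} → a + c ≤ d * m →
                 (+ a) / d +ℚ (+ c) / d ≤ℚ (+ m) / 1
fractions-sum≤ a c m d@(suc k) a+c≤dm =
  ℚ.toℚᵘ-cancel-≤ (ℚᵘ.≤-respʳ-≃ (ℚᵘ.≃-sym (ℚ.toℚᵘ-fromℚᵘ (ℚᵘ.mkℚᵘ (+ m) 0)))
                  (ℚᵘ.≤-respˡ-≃ (ℚᵘ.≃-sym lhs≃)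
                    (ℚᵘ.*≤* (subst₂ ℤ._≤_ cast-lhs (ℤ.pos-* m (d * d)) (ℤ.+≤+ cross-multiplied)))))
  where
  lhs≃ : toℚᵘ ((+ a) / d +ℚ (+ c) / d) ℚᵘ.≃ ℚᵘ.mkℚᵘ (+ a) k ℚᵘ.+ ℚᵘ.mkℚᵘ (+ c) k
  lhs≃ = ℚᵘ.≃-trans (ℚ.toℚᵘ-homo-+ ((+ a) / d) ((+ c) / d))
                    (ℚᵘ.+-cong (ℚ.toℚᵘ-fromℚᵘ (ℚᵘ.mkℚᵘ (+ a) k)) (ℚ.toℚᵘ-fromℚᵘ (ℚᵘ.mkℚᵘ (+ c) k)))
  cross-multiplied : (a * d + c * d) * 1 ≤ m * (d * d)
  cross-multiplied = begin
    (a * d + c * d) * 1  ≡⟨ *-identityʳ _ ⟩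
    a * d + c * d        ≡⟨ *-distribʳ-+ d a c ⟨
    (a + c) * d          ≤⟨ *-monoˡ-≤ d a+c≤dm ⟩
    d * m * d            ≡⟨ cong (_* d) (*-comm d m) ⟩
    m * d * d            ≡⟨ *-assoc m d d ⟩
    m * (d * d)          ∎
    where open ≤-Reasoning
  cast-lhs : + ((a * d + c * d) * 1) ≡ (+ a ℤ.* + d ℤ.+ + c ℤ.* + d) ℤ.* + 1
  cast-lhs = trans (ℤ.pos-* (a * d + c * d) 1)
                   (cong (ℤ._* + 1) (trans (ℤ.pos-+ (a * d) (c * d)) (cong₂ ℤ._+_ (ℤ.pos-* a d) (ℤ.pos-* c d))))

duration+Δ∸1≤[1+k]Δ : ∀ {t₁ tₖ k Δ} → 1 ≤ Δ → tₖ ≤ t₁ + k * Δ →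
                      duration t₁ tₖ + (Δ ∸ 1) ≤ suc k * Δ
duration+Δ∸1≤[1+k]Δ {t₁} {tₖ} {k} {Δ} 1≤Δ tₖ≤t₁+kΔ = begin
  tₖ ∸ t₁ + 1 + (Δ ∸ 1)  ≤⟨ +-monoˡ-≤ (Δ ∸ 1) (+-monoˡ-≤ 1 (m≤n+o⇒m∸n≤o tₖ t₁ tₖ≤t₁+kΔ)) ⟩
  k * Δ + 1 + (Δ ∸ 1)    ≡⟨ +-assoc (k * Δ) 1 (Δ ∸ 1) ⟩
  k * Δ + (1 + (Δ ∸ 1))  ≡⟨ cong (λ m → k * Δ + m) (m+[n∸m]≡n 1≤Δ) ⟩
  k * Δ + Δ              ≡⟨ +-comm (k * Δ) Δ ⟩
  suc k * Δ              ∎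
  where open ≤-Reasoning

mainTheorem16 : ∀ {n : ℕ} (G : Graph n) (Δ : ℕ) (L : Labeling G Δ) → Connected G
                → (u v : Fin n) → u ≢ v → (d : ℕ) → .{{_ : NonZero d}} → IsDist G u v d
                → StretchAtMost L u v d ((+ Δ) / 1 - (+ (Δ ∸ 1)) / d)
mainTheorem16 G Δ L _ u v _ (suc k) (w@(step a _) , shortest) =
  let t₁ , tₖ , path , tₖ≤t₁+kΔ = shortest-walk⇒temporal-path L w shortest
      1≤Δ = ≤-trans (proj₁ (lab-range L a)) (proj₂ (lab-range L a))
      duration-bound = duration+Δ∸1≤[1+k]Δ {t₁} {tₖ} {k} 1≤Δ tₖ≤t₁+kΔ
  in t₁ , tₖ , path , p+q≤r⇒p≤r-q (fractions-sum≤ (duration t₁ tₖ) (Δ ∸ 1) Δ (suc k) duration-bound)
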